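{- Let $k\ge1$ be an integer, let $T'$ be any finite tree, and let $T$ be the tree obtained from $T'$ by attaching, for every vertex $v\in V(T')$, a new path $P_v=v_1v_2\cdots v_k$ on $k$ vertices via the edge $vv_1$. If $n=|V(T)|$, then $\gamma_{all,k}^\infty(T)=\left\lceil \frac{n}{k+1}\right\rceil$.
   Context: Eternal distance-$k$ domination: guards are placed on vertices of a graph $G$ (several guards may occupy the same vertex) so that the occupied vertices form a distance-$k$ dominating set (every vertex within distance $k$ of an occupied vertex). In each round an attacker chooses a vertex; every guard may move to any vertex at distance at most $k$ from its current position (or stay), after which the attacked vertex must be occupied and the occupied vertices again distance-$k$ dominating. $\gamma_{all,k}^\infty(G)$ is the minimum number of guards allowing the guards to answer every infinite sequence of attacks. -}

module Defs where

open import Level using (Level; suc; zero)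
open import Data.Nat using (ℕ; _≤_; _+_; _/_) renaming (suc to sucℕ; zero to zeroℕ)
open import Data.Fin using (Fin; inject₁) renaming (zero to fzero; suc to fsuc)
open import Data.Product using (Σ; ∃; _×_; _,_)
open import Relation.Binary.PropositionalEquality using (_≡_; _≢_)
open import Relation.Nullary using (¬_)
open import Function.Definitions using (Injective)

record Graph (V : Set) : Set₁ where
  field
    Adj     : V → V → Set
    symAdj  : ∀ {u v} → Adj u v → Adj v u
    irrefl  : ∀ {v} → ¬ Adj v v
open Graph public

-- Near G j u v : there is a walk of length at most j from u to v,
-- i.e. dist_G(u,v) ≤ j.
data Near {V : Set} (G : Graph V) : ℕ → V → V → Set where
  here : ∀ {j u} → Near G j u u
  step : ∀ {j u w v} → Adj G u w → Near G j w v → Near G (sucℕ j) u v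

Connected : {V : Set} → Graph V → Set
Connected G = ∀ u v → ∃ λ j → Near G j u v

-- A cycle: pairwise distinct vertices c 0, …, c m (m ≥ 2, i.e. ≥ 3 vertices),
-- consecutive ones adjacent and c m adjacent to c 0.
record Cycle {V : Set} (G : Graph V) : Set where
  field
    m        : ℕ
    long     : 2 ≤ m
    c        : Fin (sucℕ m) → V
    distinct : Injective _≡_ _≡_ c
    path     : ∀ (i : Fin m) → Adj G (c (inject₁ i)) (c (fsuc i))
    close    : Adj G (c (Data.Fin.fromℕ m)) (c fzero)

Acyclic : {V : Set} → Graph V → Set
Acyclic G = ¬ Cycle G

-- A finite tree: connected acyclic graph (finiteness comes from the vertex type Fin p).
IsTree : {V : Set} → Graph V → Set
IsTree G = Connected G × Acyclic G

Config : Set → ℕ → Set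
Config V m = Fin m → V

Occupied : {V : Set} {m : ℕ} → Config V m → V → Set
Occupied C v = ∃ λ i → C i ≡ v

DistDominating : {V : Set} → Graph V → ℕ → {m : ℕ} → Config V m → Set
DistDominating G k C = ∀ v → ∃ λ i → Near G k (C i) v

Move : {V : Set} → Graph V → ℕ → {m : ℕ} → Config V m → Config V m → Set
Move G k C C' = ∀ i → Near G k (C i) (C' i)

-- m guards can answer every infinite sequence of attacks iff there is a nonempty
-- family F of distance-k dominating configurations such that from every member,
-- for every attacked vertex v, the guards can move to a member of F occupying v.
EternalWins : {V : Set} → Graph V → ℕ → ℕ → Set₁
EternalWins {V} G k m =
  Σ (Config V m → Set) λ F →
    (∃ λ C → F C) ×
    (∀ C → F C → DistDominating G k C) ×
    (∀ C → F C → ∀ v → ∃ λ C' → F C' × Move G k C C' × Occupied C' v)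

IsEternalDistDomNumber : {V : Set} → Graph V → ℕ → ℕ → Set₁
IsEternalDistDomNumber G k γ = EternalWins G k γ × (∀ m → EternalWins G k m → γ ≤ m)

-- The construction: vertex (v , 0) is v ∈ V(T'), vertex (v , j) for 1 ≤ j ≤ k is v_j.

data CoronaAdj {p : ℕ} (G : Graph (Fin p)) (k : ℕ) : Fin p × Fin (sucℕ k) → Fin p × Fin (sucℕ k) → Set where
  base : ∀ {u v} → Adj G u v → CoronaAdj G k (u , fzero) (v , fzero)
  up   : ∀ {v} (i : Fin k) → CoronaAdj G k (v , inject₁ i) (v , fsuc i)
  down : ∀ {v} (i : Fin k) → CoronaAdj G k (v , fsuc i) (v , inject₁ i)

private
  inj≢suc : ∀ {n} (i : Fin n) → inject₁ i ≢ fsuc i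
  inj≢suc fzero ()
  inj≢suc (fsuc i) eq = inj≢suc i (Data.Fin.Properties.suc-injective eq)
    where import Data.Fin.Properties

  corSym : ∀ {p} {G : Graph (Fin p)} {k x y} → CoronaAdj G k x y → CoronaAdj G k y x
  corSym {G = G} (base a) = base (symAdj G a)
  corSym (up i) = down i
  corSym (down i) = up i

  corIrr′ : ∀ {p} {G : Graph (Fin p)} {k x y} → CoronaAdj G k x y → x ≢ y
  corIrr′ {G = G} (base a) Relation.Binary.PropositionalEquality.refl = irrefl G a
  corIrr′ (up i) eq = inj≢suc i (Data.Product.Properties.,-injectiveʳ eq)
    where import Data.Product.Properties
  corIrr′ (down i) eq = inj≢suc i (Relation.Binary.PropositionalEquality.sym (Data.Product.Properties.,-injectiveʳ eq))
    where import Data.Product.Properties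

  corIrr : ∀ {p} {G : Graph (Fin p)} {k x} → ¬ CoronaAdj G k x x
  corIrr a = corIrr′ a Relation.Binary.PropositionalEquality.refl

attachPaths : {p : ℕ} → Graph (Fin p) → (k : ℕ) → Graph (Fin p × Fin (sucℕ k))
attachPaths G k = record { Adj = CoronaAdj G k ; symAdj = corSym ; irrefl = corIrr }

{-# OPTIONS --safe #-}
module Submission where

open import Defs
open import Data.Nat using (ℕ; _≤_; _+_; _/_; suc)
open import Data.Fin using (Fin)
open import Data.Product using (_×_)
open import Function.Bundles using (_↔_)

open import Data.Nat using (_*_; _<_; z≤n; s≤s)
open import Data.Nat.Properties
  using (≤-reflexive; ≤-trans; n≤1+n; n<1+n; m≤m+n; m≤n+m; +-monoˡ-≤; +-suc; +-identityʳ; m+n≮n; module ≤-Reasoning)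
open import Data.Nat.DivMod using (+-distrib-/-∣ˡ; m*n/n≡m; m<n⇒m/n≡0)
open import Data.Nat.Divisibility using (divides-refl)
open import Data.Fin using (toℕ; inject₁; fromℕ; _≟_) renaming (zero to fzero; suc to fsuc)
open import Data.Fin.Properties using (toℕ-inject₁; toℕ-fromℕ; injective⇒≤; *↔×)
open import Data.Fin.Permutation using (↔⇒≡)
open import Data.Vec.Functional using (updateAt)
open import Data.Vec.Functional.Properties using (updateAt-updates; updateAt-minimal)
open import Data.Product using (∃; _,_; proj₁; proj₂)
open import Function using (_∘_; const)
open import Function.Definitions using (Injective)
open import Function.Properties.Inverse using (↔-sym; ↔-trans)
open import Relation.Nullary using (yes; no; contradiction)
open import Relation.Nullary.Decidable using (decidable-stable)
open import Relation.Binary.PropositionalEquality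

-- Together with v, the path P_v forms a column of k + 1 vertices, any two of them at
-- distance at most k.  A walk from one column to another has to descend to the root of
-- its column and cross an edge of T′, so only a guard in the column of v is within
-- distance k of the tip v_k: a distance-k dominating set meets all p columns.  Conversely
-- p guards, one per column, defend forever, each column's guard answering the attacks on
-- its own column.  Since n = p (k + 1), p = ⌈n / (k + 1)⌉ = ⌊(n + k) / (k + 1)⌋.

module _ {V : Set} (G : Graph V) where

  Near-mono : ∀ {i j x y} → i ≤ j → Near G i x y → Near G j x y
  Near-mono _         here       = here
  Near-mono (s≤s i≤j) (step e w) = step e (Near-mono i≤j w)

  Near-snoc : ∀ {j x y z} → Near G j x y → Adj G y z → Near G (suc j) x z
  Near-snoc here        e = step e here
  Near-snoc (step e′ w) e = step e′ (Near-snoc w e)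

  Near-sym : ∀ {j x y} → Near G j x y → Near G j y x
  Near-sym here       = here
  Near-sym (step e w) = Near-snoc (Near-sym w) (symAdj G e)

  Near-path : ∀ {m} (c : Fin (suc m) → V) → (∀ i → Adj G (c (inject₁ i)) (c (fsuc i))) →
              ∀ a b → Near G m (c a) (c b)
  Near-path         c edge fzero    fzero    = here
  Near-path {suc m} c edge fzero    (fsuc b) =
    step (edge fzero) (Near-path (c ∘ fsuc) (edge ∘ fsuc) fzero b)
  Near-path {suc m} c edge (fsuc a) fzero    =
    Near-sym (step (edge fzero) (Near-path (c ∘ fsuc) (edge ∘ fsuc) fzero a))
  Near-path {suc m} c edge (fsuc a) (fsuc b) =
    Near-mono (n≤1+n m) (Near-path (c ∘ fsuc) (edge ∘ fsuc) a b)

module _ {p : ℕ} (T : Graph (Fin p)) (k : ℕ) where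

  private
    G : Graph (Fin p × Fin (suc k))
    G = attachPaths T k

  column : Fin p × Fin (suc k) → Fin p
  column = proj₁

  height : Fin p × Fin (suc k) → ℕ
  height = toℕ ∘ proj₂

  sameColumn⇒Near : ∀ {x y} → column x ≡ column y → Near G k x y
  sameColumn⇒Near {v , a} {.v , b} refl = Near-path G (v ,_) up a b

  height-Adj : ∀ {x y} → Adj G x y → height y ≤ suc (height x)
  height-Adj (base _) = z≤n
  height-Adj (up i)   = s≤s (≤-reflexive (sym (toℕ-inject₁ i)))
  height-Adj (down i) = ≤-trans (≤-reflexive (toℕ-inject₁ i)) (m≤n+m (toℕ i) 2)

  height-Near : ∀ {j x y} → Near G j x y → height y ≤ height x + j
  height-Near {j} {x} here = m≤m+n (height x) j
  height-Near {suc j} {x} {y} (step {w = w} e walk) = begin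
    height y           ≤⟨ height-Near walk ⟩
    height w + j       ≤⟨ +-monoˡ-≤ j (height-Adj e) ⟩
    suc (height x) + j ≡⟨ +-suc (height x) j ⟨
    height x + suc j   ∎
    where open ≤-Reasoning

  private
    height+<-step : ∀ {j x w h} → Adj G x w → height w + h < j → height x + h < suc j
    height+<-step {h = h} e lt = s≤s (≤-trans (+-monoˡ-≤ h (height-Adj (symAdj G e))) lt)

  Near-otherColumn⇒height+height< : ∀ {j x y} → Near G j x y → column x ≢ column y →
                                    height x + height y < j
  Near-otherColumn⇒height+height< here              x≢y = contradiction refl x≢y
  Near-otherColumn⇒height+height< (step (base _) w) _   = s≤s (height-Near w)
  Near-otherColumn⇒height+height< (step e@(up _) w) x≢y =
    height+<-step e (Near-otherColumn⇒height+height< w x≢y)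
  Near-otherColumn⇒height+height< (step e@(down _) w) x≢y =
    height+<-step e (Near-otherColumn⇒height+height< w x≢y)

  Near-tip⇒sameColumn : ∀ {x v} → Near G k x (v , fromℕ k) → column x ≡ v
  Near-tip⇒sameColumn {x} {v} walk = decidable-stable (column x ≟ v) λ x≢v →
    m+n≮n (height x) k
      (subst (λ t → height x + t < k) (toℕ-fromℕ k) (Near-otherColumn⇒height+height< walk x≢v))

  columns≤guards : ∀ {m} {C : Config (Fin p × Fin (suc k)) m} → DistDominating G k C → p ≤ m
  columns≤guards {m} {C} dominating = injective⇒≤ guardAtTip-injective
    where
    guardAtTip : Fin p → Fin m
    guardAtTip v = proj₁ (dominating (v , fromℕ k))

    column-guardAtTip : ∀ v → column (C (guardAtTip v)) ≡ v
    column-guardAtTip v = Near-tip⇒sameColumn (proj₂ (dominating (v , fromℕ k)))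

    guardAtTip-injective : Injective _≡_ _≡_ guardAtTip
    guardAtTip-injective {u} {v} eq =
      trans (sym (column-guardAtTip u)) (trans (cong (column ∘ C) eq) (column-guardAtTip v))

  wins⇒columns≤guards : ∀ m → EternalWins G k m → p ≤ m
  wins⇒columns≤guards m (_ , (C , C∈F) , dominating , _) = columns≤guards (dominating C C∈F)

  OnePerColumn : Config (Fin p × Fin (suc k)) p → Set
  OnePerColumn C = ∀ v → column (C v) ≡ v

  onePerColumn-wins : EternalWins G k p
  onePerColumn-wins = OnePerColumn , ((_, fzero) , λ _ → refl) , dominating , respond
    where
    dominating : ∀ C → OnePerColumn C → DistDominating G k C
    dominating C ok y = column y , sameColumn⇒Near (ok (column y))

    respond : ∀ C → OnePerColumn C → ∀ y →
              ∃ λ C′ → OnePerColumn C′ × Move G k C C′ × Occupied C′ y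
    respond C ok (u , b) = C′ , ok′ , move , (u , updateAt-updates u C)
      where
      C′ = updateAt C u (const (u , b))

      ok′ : OnePerColumn C′
      ok′ v with v ≟ u
      ... | yes refl = cong column (updateAt-updates v C)
      ... | no v≢u   = trans (cong column (updateAt-minimal v u C v≢u)) (ok v)

      move : Move G k C C′
      move v with v ≟ u
      ... | yes refl = subst (Near G k (C v)) (sym (updateAt-updates v C)) (sameColumn⇒Near (ok v))
      ... | no v≢u   = subst (Near G k (C v)) (sym (updateAt-minimal v u C v≢u)) here

[m*[1+n]+n]/[1+n]≡m : ∀ m n → (m * suc n + n) / suc n ≡ m
[m*[1+n]+n]/[1+n]≡m m n = begin
  (m * suc n + n) / suc n         ≡⟨ +-distrib-/-∣ˡ n (divides-refl m) ⟩
  m * suc n / suc n + n / suc n   ≡⟨ cong₂ _+_ (m*n/n≡m m (suc n)) (m<n⇒m/n≡0 (n<1+n n)) ⟩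
  m + 0                           ≡⟨ +-identityʳ m ⟩
  m                               ∎
  where open ≡-Reasoning

mainTheorem6 : (k : ℕ) → 1 ≤ k → (p : ℕ) → (T′ : Graph (Fin p)) → IsTree T′ →
    (n : ℕ) → Fin n ↔ (Fin p × Fin (suc k)) →
    IsEternalDistDomNumber (attachPaths T′ k) k ((n + k) / suc k)
mainTheorem6 k _ p T′ _ n n↔ =
  subst (IsEternalDistDomNumber (attachPaths T′ k) k) (sym guards≡p)
    (onePerColumn-wins T′ k , wins⇒columns≤guards T′ k)
  where
  n≡p*[1+k] : n ≡ p * suc k
  n≡p*[1+k] = ↔⇒≡ (↔-trans n↔ (↔-sym *↔×))

  guards≡p : (n + k) / suc k ≡ p
  guards≡p = trans (cong (λ t → (t + k) / suc k) n≡p*[1+k]) ([m*[1+n]+n]/[1+n]≡m p k)
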